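{- Let $X=X_1\uplus\cdots\uplus X_M$ with $|X_i|=m_i\ge1$, and consider simple families $\mathcal{F}$ of subsets of $X$ such that for all distinct $E,F\in\mathcal{F}$ there is a $j\in[M]$ such that $E\cap X_j$ and $F\cap X_j$ are incomparable (neither contains the other). If $\mathcal{F}$ has maximum size among these families, then $$|\mathcal{F}|=\prod_{i=1}^M\binom{m_i}{\lfloor m_i/2\rfloor}.$$ A family $\mathcal{F}$ of this kind is a maximum size homogeneous family precisely when $\mathcal{F}$ consists of all subsets $F\subseteq X$ with $|F\cap X_i|=\ell_i$ for all $i$, for some $(\ell_1,\ldots,\ell_M)$ with $\ell_i\in\{\lfloor m_i/2\rfloor,\lceil m_i/2\rceil\}$ for each $i\in[M]$ (equivalently, its profile matrix is $S(\{(\ell_1,\ldots,\ell_M)\})$). In particular, when all $m_i$ are even, the maximum size family is unique and homogeneous.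
   Context: A family is homogeneous if membership of a subset $F\subseteq X$ depends only on its profile vector $(|F\cap X_1|,\ldots,|F\cap X_M|)$. For $I\subseteq\prod_i\{0,\ldots,m_i\}$, $S(I)$ is the matrix indexed by $\prod_i\{0,\ldots,m_i\}$ with entry $\prod_j\binom{m_j}{i_j}$ at $(i_1,\ldots,i_M)\in I$ and $0$ elsewhere. -}

module Defs where

open import Data.Nat using (ℕ; zero; suc; _*_; _≤_)
open import Data.Fin using (Fin; zero; suc; _≟_)
open import Data.Fin.Subset using (Subset; Side; inside; outside; _∩_; _⊆_; ∣_∣)
open import Data.Vec using (tabulate)
open import Data.List using (List; length)
open import Data.List.Membership.Propositional using (_∈_)
open import Data.List.Relation.Unary.AllPairs using (AllPairs)
open import Data.Product using (_×_; ∃-syntax)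
open import Relation.Nullary using (¬_; does)
open import Relation.Binary.PropositionalEquality using (_≗_)
open import Data.Bool using (if_then_else_)

-- Ground set X = Fin N, partitioned into blocks X_1,...,X_M by blk : Fin N → Fin M.
-- X_i = block blk i.
block : {N M : ℕ} → (Fin N → Fin M) → Fin M → Subset N
block blk i = tabulate (λ x → if does (blk x ≟ i) then inside else outside)

blockSize : {N M : ℕ} → (Fin N → Fin M) → Fin M → ℕ
blockSize blk i = ∣ block blk i ∣

Incomparable : {N : ℕ} → Subset N → Subset N → Set
Incomparable A B = ¬ (A ⊆ B) × ¬ (B ⊆ A)

Separated : {N M : ℕ} → (Fin N → Fin M) → Subset N → Subset N → Set
Separated blk E F = ∃[ j ] Incomparable (E ∩ block blk j) (F ∩ block blk j)

-- A family is given as a list of subsets; every pair of entries at distinct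
-- positions must be separated.  (This forces the list to be duplicate-free,
-- since a set is comparable with itself, so it is a simple family and its
-- size is the list length.)
Valid : {N M : ℕ} → (Fin N → Fin M) → List (Subset N) → Set
Valid blk 𝓕 = AllPairs (Separated blk) 𝓕

Maximum : {N M : ℕ} → (Fin N → Fin M) → List (Subset N) → Set
Maximum blk 𝓕 = Valid blk 𝓕 × (∀ 𝓖 → Valid blk 𝓖 → length 𝓖 ≤ length 𝓕)

profile : {N M : ℕ} → (Fin N → Fin M) → Subset N → Fin M → ℕ
profile blk S i = ∣ S ∩ block blk i ∣

Homogeneous : {N M : ℕ} → (Fin N → Fin M) → List (Subset N) → Set
Homogeneous blk 𝓕 =
  ∀ S T → profile blk S ≗ profile blk T → S ∈ 𝓕 → T ∈ 𝓕

prodFin : (M : ℕ) → (Fin M → ℕ) → ℕ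
prodFin zero    f = 1
prodFin (suc M) f = f zero * prodFin M (λ i → f (suc i))

module Submission where

-- The proof is a weighted LYM argument.  A product chain of X = X₁ ⊎ ⋯ ⊎ X_M
-- is a choice of one maximal chain in every block, so there are ∏ mᵢ! of
-- them, and ∏ kᵢ! (mᵢ − kᵢ)! of them pass through a set with profile k.
-- Two sets separated in some block never lie on a common product chain,
-- hence for a valid family Σ_{S ∈ F} ∏ kᵢ(S)! (mᵢ − kᵢ(S))! ≤ ∏ mᵢ!.  We
-- prove this relative to an arbitrary ground set R ⊆ X by induction on |R|,
-- sorting the chains by their first element in one block (weighted-lym).
-- Since k!(m − k)! is smallest exactly at k ∈ {⌊m/2⌋, ⌈m/2⌉}, the inequality
-- gives |F| ≤ ∏ C(mᵢ, ⌊mᵢ/2⌋); a central profile class attains the bound,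
-- and in a maximum family the inequality is tight, which forces every member
-- to have a central profile.  Comparing a homogeneous family with an
-- explicit enumeration of profile classes then yields the characterisation,
-- and for even blocks the unique central profile gives uniqueness.

open import Defs
open import Algebra.Bundles using (CommutativeMonoid)
import Algebra.Properties.CommutativeSemigroup as CommSemigroup
open import Data.Bool using (Bool; true; false; _∧_; _∨_; not; T; if_then_else_)
import Data.Bool as Bool
open import Data.Bool.Properties
  using (⇔→≡; ∨-zeroʳ; ∧-zeroʳ; ∧-identityʳ; ∧-conicalˡ; ∧-conicalʳ; ∧-commutativeMonoid)
open import Data.Empty using (⊥; ⊥-elim)
open import Data.Fin using (Fin; zero; suc; _≟_)
import Data.Fin.Properties as Fin
open import Data.Fin.Subset using (Subset; inside; outside; _∩_; _⊆_; ∣_∣)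
open import Data.Fin.Subset.Properties using (∣p∩q∣≤∣q∣)
open import Data.List using (List; []; _∷_; _++_; map; length)
open import Data.List.Properties using (length-++; length-map)
open import Data.List.Membership.Propositional using (_∈_)
open import Data.List.Membership.Propositional.Properties using (∈-map⁻; ∈-++⁻; ∈-++⁺ˡ; ∈-++⁺ʳ; ∈-∃++)
import Data.List.Membership.DecPropositional as DecMembership
open import Data.List.Relation.Unary.Any using (here; there)
open import Data.List.Relation.Unary.All as All using (All; []; _∷_)
open import Data.List.Relation.Unary.AllPairs as AllPairs using (AllPairs; []; _∷_)
import Data.List.Relation.Unary.AllPairs.Properties as AllPairs
open import Data.List.Relation.Unary.Unique.Propositional using (Unique)
import Data.List.Relation.Unary.Unique.Propositional.Properties as Unique
open import Data.Nat
  using (ℕ; zero; suc; _+_; _*_; _∸_; _≤_; _<_; z≤n; s≤s; NonZero; >-nonZero; _!; ⌊_/2⌋; ⌈_/2⌉; _≡ᵇ_)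
open import Data.Nat.Properties hiding (_≟_)
open import Data.Nat.Properties using () renaming (_≟_ to _≟ℕ_)
open import Algebra.Properties.Semiring.Sum +-*-semiring
  using (sum; sum-cong-≗; sum-replicate-zero; ∑-distrib-+; *-distribˡ-sum; *-distribʳ-sum)
open import Data.Nat.Combinatorics
  using (_C_; nCk≡n!/k![n-k]!; nCk≡nC[n∸k]; k![n∸k]!∣n!; k>n⇒nCk≡0; nCk+nC[k+1]≡[n+1]C[k+1])
open import Data.Nat.Divisibility using (_∣_; divides; ∣⇒≤)
open import Data.Nat.DivMod using (m/n*n≡m)
open import Data.Product using (_×_; _,_; ∃-syntax; proj₁; proj₂)
open import Data.Sum using (_⊎_; inj₁; inj₂)
open import Data.Unit using (tt)
open import Data.Vec using (_∷_; []; lookup)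
import Data.Vec.Properties as Vec
open import Data.Vec.Functional using (updateAt)
open import Data.Vec.Functional.Properties using (updateAt-updates; updateAt-minimal)
open import Function using (_∘_)
open import Function.Bundles using (_⇔_; mk⇔; Equivalence)
open import Relation.Nullary using (¬_; does; yes; no)
open import Relation.Nullary.Decidable using (dec-true; dec-false)
open import Relation.Binary.PropositionalEquality

private
  module +-Comm = CommSemigroup +-commutativeSemigroup
  module *-Comm = CommSemigroup *-commutativeSemigroup
  module ∧-Comm = CommSemigroup (CommutativeMonoid.commutativeSemigroup ∧-commutativeMonoid)

𝟙 : Bool → ℕ
𝟙 true  = 1
𝟙 false = 0

count : ∀ {n} → (Fin n → Bool) → ℕ
count p = sum (λ x → 𝟙 (p x))

false≢true : false ≢ true
false≢true ()

_⊆ᵇ_ : ∀ {n} → (Fin n → Bool) → (Fin n → Bool) → Set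
p ⊆ᵇ q = ∀ x → p x ≡ true → q x ≡ true

remove : ∀ {n} → (Fin n → Bool) → Fin n → Fin n → Bool
remove p x y = p y ∧ not (does (y ≟ x))

remove-⊆ : ∀ {n} (s : Fin n → Bool) x → remove s x ⊆ᵇ s
remove-⊆ s x y = ∧-conicalˡ (s y) (not (does (y ≟ x)))

remove-mono : ∀ {n} {s t : Fin n → Bool} → s ⊆ᵇ t → ∀ x → remove s x ⊆ᵇ remove t x
remove-mono {s = s} s⊆t x y y∈s-x =
  cong₂ _∧_ (s⊆t y (remove-⊆ s x y y∈s-x)) (∧-conicalʳ (s y) (not (does (y ≟ x))) y∈s-x)

sum-mono : ∀ {n} {f g : Fin n → ℕ} → (∀ x → f x ≤ g x) → sum f ≤ sum g
sum-mono {zero}  f≤g = z≤n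
sum-mono {suc n} f≤g = +-mono-≤ (f≤g zero) (sum-mono (f≤g ∘ suc))

sum-zero : ∀ {n} {f : Fin n → ℕ} → (∀ x → f x ≡ 0) → sum f ≡ 0
sum-zero {n} f≡0 = trans (sum-cong-≗ f≡0) (sum-replicate-zero n)

count-cong : ∀ {n} {p q : Fin n → Bool} → p ≗ q → count p ≡ count q
count-cong p≗q = sum-cong-≗ (cong 𝟙 ∘ p≗q)

𝟙-mono : ∀ {a b} → (a ≡ true → b ≡ true) → 𝟙 a ≤ 𝟙 b
𝟙-mono {false} a⇒b = z≤n
𝟙-mono {true}  a⇒b rewrite a⇒b refl = ≤-refl

𝟙-injective : ∀ {a b} → 𝟙 a ≡ 𝟙 b → a ≡ b
𝟙-injective {false} {false} _ = refl
𝟙-injective {true}  {true}  _ = refl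

count-mono : ∀ {n} {p q : Fin n → Bool} → p ⊆ᵇ q → count p ≤ count q
count-mono p⊆q = sum-mono (λ x → 𝟙-mono (p⊆q x))

count-remove : ∀ {n} (p : Fin n → Bool) (x : Fin n) →
  count p ≡ 𝟙 (p x) + count (remove p x)
count-remove {suc n} p zero = cong (𝟙 (p zero) +_) (begin
  count (p ∘ suc)                          ≡⟨ count-cong (λ y → sym (∧-identityʳ (p (suc y)))) ⟩
  count (remove p zero ∘ suc)              ≡⟨⟩
  𝟙 false + count (remove p zero ∘ suc)
    ≡⟨ cong (λ b → 𝟙 b + count (remove p zero ∘ suc)) (sym (∧-zeroʳ (p zero))) ⟩
  count (remove p zero)                    ∎)
  where open ≡-Reasoning
count-remove {suc (suc n)} p (suc x) = begin
  𝟙 (p zero) + count (p ∘ suc)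
    ≡⟨ cong (𝟙 (p zero) +_) (count-remove (p ∘ suc) x) ⟩
  𝟙 (p zero) + (𝟙 (p (suc x)) + count (remove (p ∘ suc) x))
    ≡⟨ +-Comm.x∙yz≈y∙xz (𝟙 (p zero)) (𝟙 (p (suc x))) _ ⟩
  𝟙 (p (suc x)) + (𝟙 (p zero) + count (remove (p ∘ suc) x))
    ≡⟨ cong (λ b → 𝟙 (p (suc x)) + (𝟙 b + count (remove (p ∘ suc) x))) (sym (∧-identityʳ (p zero))) ⟩
  𝟙 (p (suc x)) + count (remove p (suc x)) ∎
  where open ≡-Reasoning

count-zero : ∀ {n} (p : Fin n → Bool) → count p ≡ 0 → ∀ y → p y ≡ false
count-zero p count≡0 zero with p zero
... | false = refl
count-zero p count≡0 (suc y) with p zero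
... | false = count-zero (p ∘ suc) count≡0 y

count-pos : ∀ {n} (p : Fin n → Bool) {k} → count p ≡ suc k → ∃[ y ] p y ≡ true
count-pos {suc n} p count≡1+k with p zero in p0
... | true  = zero , p0
... | false = let y , py = count-pos (p ∘ suc) count≡1+k in suc y , py

+-tight : ∀ {a b c d} → a ≤ c → b ≤ d → a + b ≡ c + d → a ≡ c × b ≡ d
+-tight a≤c b≤d eq with m≤n⇒m<n∨m≡n a≤c | m≤n⇒m<n∨m≡n b≤d
... | inj₂ a≡c | inj₂ b≡d = a≡c , b≡d
... | inj₁ a<c | _        = ⊥-elim (<⇒≢ (+-mono-<-≤ a<c b≤d) eq)
... | inj₂ _   | inj₁ b<d = ⊥-elim (<⇒≢ (+-mono-≤-< a≤c b<d) eq)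

⊆ᵇ-count-≡ : ∀ {n} {p q : Fin n → Bool} → p ⊆ᵇ q → count p ≡ count q → q ⊆ᵇ p
⊆ᵇ-count-≡ {suc n} {p} {q} p⊆q count≡ = go
  where
  parts : 𝟙 (p zero) ≡ 𝟙 (q zero) × count (p ∘ suc) ≡ count (q ∘ suc)
  parts = +-tight (𝟙-mono (p⊆q zero)) (count-mono (p⊆q ∘ suc)) count≡
  go : q ⊆ᵇ p
  go zero    q0 = trans (𝟙-injective (proj₁ parts)) q0
  go (suc y) = ⊆ᵇ-count-≡ (p⊆q ∘ suc) (proj₂ parts) y

scaled-sum-≡ : ∀ {n} c W (B : Fin n → Bool) (g : Fin n → ℕ) →
  (∀ x → B x ≡ true → c * g x ≡ W) → (∀ x → B x ≡ false → g x ≡ 0) →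
  c * sum g ≡ count B * W
scaled-sum-≡ c W B g on off = begin
  c * sum g                ≡⟨ *-distribˡ-sum c g ⟩
  sum (λ x → c * g x)      ≡⟨ sum-cong-≗ (λ x → pointwise x (B x) refl) ⟩
  sum (λ x → 𝟙 (B x) * W)  ≡⟨ sym (*-distribʳ-sum W (λ x → 𝟙 (B x))) ⟩
  count B * W              ∎
  where
  open ≡-Reasoning
  pointwise : ∀ x v → B x ≡ v → c * g x ≡ 𝟙 v * W
  pointwise x true  Bx = trans (on x Bx) (sym (+-identityʳ W))
  pointwise x false Bx = trans (cong (c *_) (off x Bx)) (*-zeroʳ c)

scaled-sum-≤ : ∀ {n} c W (B : Fin n → Bool) (g : Fin n → ℕ) →
  (∀ x → B x ≡ true → c * g x ≤ W) → (∀ x → B x ≡ false → g x ≡ 0) →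
  c * sum g ≤ count B * W
scaled-sum-≤ c W B g on off = begin
  c * sum g                ≡⟨ *-distribˡ-sum c g ⟩
  sum (λ x → c * g x)      ≤⟨ sum-mono (λ x → pointwise x (B x) refl) ⟩
  sum (λ x → 𝟙 (B x) * W)  ≡⟨ sym (*-distribʳ-sum W (λ x → 𝟙 (B x))) ⟩
  count B * W              ∎
  where
  open ≤-Reasoning
  pointwise : ∀ x v → B x ≡ v → c * g x ≤ 𝟙 v * W
  pointwise x true  Bx = ≤-trans (on x Bx) (≤-reflexive (sym (+-identityʳ W)))
  pointwise x false Bx = ≤-reflexive (trans (cong (c *_) (off x Bx)) (*-zeroʳ c))

prod-cong : ∀ M {f g : Fin M → ℕ} → (∀ i → f i ≡ g i) → prodFin M f ≡ prodFin M g
prod-cong zero    f≗g = refl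
prod-cong (suc M) f≗g = cong₂ _*_ (f≗g zero) (prod-cong M (f≗g ∘ suc))

prod-mono : ∀ M {f g : Fin M → ℕ} → (∀ i → f i ≤ g i) → prodFin M f ≤ prodFin M g
prod-mono zero    f≤g = ≤-refl
prod-mono (suc M) f≤g = *-mono-≤ (f≤g zero) (prod-mono M (f≤g ∘ suc))

prod-pos : ∀ M (f : Fin M → ℕ) → (∀ i → 0 < f i) → 0 < prodFin M f
prod-pos zero    f pos = s≤s z≤n
prod-pos (suc M) f pos = *-mono-< (pos zero) (prod-pos M (f ∘ suc) (pos ∘ suc))

prod-mul : ∀ M (f g : Fin M → ℕ) → prodFin M f * prodFin M g ≡ prodFin M (λ i → f i * g i)
prod-mul zero    f g = refl
prod-mul (suc M) f g = trans (*-Comm.interchange (f zero) _ (g zero) _)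
  (cong (f zero * g zero *_) (prod-mul M (f ∘ suc) (g ∘ suc)))

prod-update : ∀ M (b : Fin M) (f h : Fin M → ℕ) c → f b ≡ c * h b →
  (∀ i → i ≢ b → f i ≡ h i) → prodFin M f ≡ c * prodFin M h
prod-update (suc M) zero f h c fb≡ off = begin
  f zero * prodFin M (f ∘ suc)  ≡⟨ cong₂ _*_ fb≡ (prod-cong M (λ i → off (suc i) λ ())) ⟩
  c * h zero * prodFin M (h ∘ suc) ≡⟨ *-assoc c (h zero) _ ⟩
  c * prodFin (suc M) h          ∎
  where open ≡-Reasoning
prod-update (suc M) (suc b) f h c fb≡ off = begin
  f zero * prodFin M (f ∘ suc)
    ≡⟨ cong₂ _*_ (off zero λ ()) (prod-update M b (f ∘ suc) (h ∘ suc) c fb≡ off′) ⟩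
  h zero * (c * prodFin M (h ∘ suc)) ≡⟨ *-Comm.x∙yz≈y∙xz (h zero) c _ ⟩
  c * prodFin (suc M) h               ∎
  where
  open ≡-Reasoning
  off′ : ∀ i → i ≢ b → f (suc i) ≡ h (suc i)
  off′ i i≢b = off (suc i) (i≢b ∘ Fin.suc-injective)

prod-split : ∀ M (b : Fin M) (f h₁ h₂ : Fin M → ℕ) → f b ≡ h₁ b + h₂ b →
  (∀ i → i ≢ b → f i ≡ h₁ i) → (∀ i → i ≢ b → f i ≡ h₂ i) →
  prodFin M f ≡ prodFin M h₁ + prodFin M h₂
prod-split (suc M) zero f h₁ h₂ fb≡ off₁ off₂ = begin
  f zero * prodFin M (f ∘ suc)
    ≡⟨ cong (_* prodFin M (f ∘ suc)) fb≡ ⟩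
  (h₁ zero + h₂ zero) * prodFin M (f ∘ suc)
    ≡⟨ *-distribʳ-+ _ (h₁ zero) (h₂ zero) ⟩
  h₁ zero * prodFin M (f ∘ suc) + h₂ zero * prodFin M (f ∘ suc)
    ≡⟨ cong₂ (λ u v → h₁ zero * u + h₂ zero * v)
             (prod-cong M (λ i → off₁ (suc i) λ ())) (prod-cong M (λ i → off₂ (suc i) λ ())) ⟩
  prodFin (suc M) h₁ + prodFin (suc M) h₂ ∎
  where open ≡-Reasoning
prod-split (suc M) (suc b) f h₁ h₂ fb≡ off₁ off₂ = begin
  f zero * prodFin M (f ∘ suc)
    ≡⟨ cong (f zero *_) (prod-split M b (f ∘ suc) (h₁ ∘ suc) (h₂ ∘ suc) fb≡ (shift off₁) (shift off₂)) ⟩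
  f zero * (prodFin M (h₁ ∘ suc) + prodFin M (h₂ ∘ suc))
    ≡⟨ *-distribˡ-+ (f zero) _ _ ⟩
  f zero * prodFin M (h₁ ∘ suc) + f zero * prodFin M (h₂ ∘ suc)
    ≡⟨ cong₂ (λ u v → u * prodFin M (h₁ ∘ suc) + v * prodFin M (h₂ ∘ suc))
             (off₁ zero λ ()) (off₂ zero λ ()) ⟩
  prodFin (suc M) h₁ + prodFin (suc M) h₂ ∎
  where
  open ≡-Reasoning
  shift : ∀ {h : Fin (suc M) → ℕ} → (∀ i → i ≢ suc b → f i ≡ h i) → ∀ i → i ≢ b → f (suc i) ≡ h (suc i)
  shift off i i≢b = off (suc i) (i≢b ∘ Fin.suc-injective)

prod-zero : ∀ M (f : Fin M → ℕ) i → f i ≡ 0 → prodFin M f ≡ 0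
prod-zero M f i fi≡0 = prod-update M i f f 0 fi≡0 (λ _ _ → refl)

prod-one : ∀ M (f : Fin M → ℕ) → (∀ i → f i ≡ 1) → prodFin M f ≡ 1
prod-one M f f≡1 = trans (prod-cong M f≡1) (one M)
  where
  one : ∀ M → prodFin M (λ _ → 1) ≡ 1
  one zero    = refl
  one (suc M) = trans (+-identityʳ _) (one M)

prod-tight : ∀ M (f g : Fin M → ℕ) → (∀ i → f i ≤ g i) → (∀ i → 0 < f i) →
  prodFin M g ≡ prodFin M f → ∀ i → g i ≡ f i
prod-tight (suc M) f g f≤g pos ∏g≡∏f = go
  where
  tail-pos : 0 < prodFin M (f ∘ suc)
  tail-pos = prod-pos M (f ∘ suc) (pos ∘ suc)
  head≡ : g zero ≡ f zero
  head≡ with m≤n⇒m<n∨m≡n (f≤g zero)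
  ... | inj₂ f0≡g0 = sym f0≡g0
  ... | inj₁ f0<g0 = ⊥-elim (<⇒≢ ∏f<∏g (sym ∏g≡∏f))
    where
    ∏f<∏g : prodFin (suc M) f < prodFin (suc M) g
    ∏f<∏g = begin-strict
      f zero * prodFin M (f ∘ suc) <⟨ *-monoˡ-< _ {{>-nonZero tail-pos}} f0<g0 ⟩
      g zero * prodFin M (f ∘ suc) ≤⟨ *-monoʳ-≤ (g zero) (prod-mono M (f≤g ∘ suc)) ⟩
      g zero * prodFin M (g ∘ suc) ∎
      where open ≤-Reasoning
  tail≡ : prodFin M (g ∘ suc) ≡ prodFin M (f ∘ suc)
  tail≡ = *-cancelˡ-≡ _ _ (f zero) {{>-nonZero (pos zero)}}
    (trans (cong (_* prodFin M (g ∘ suc)) (sym head≡)) ∏g≡∏f)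
  go : ∀ i → g i ≡ f i
  go zero    = head≡
  go (suc i) = prod-tight M (f ∘ suc) (g ∘ suc) (f≤g ∘ suc) (pos ∘ suc) tail≡ i

-- k! (m ∸ k)! is the number of maximal chains of an m-set through a fixed
-- k-subset; it is smallest exactly at the central levels ⌊m/2⌋, ⌈m/2⌉.
chainWeight : ℕ → ℕ → ℕ
chainWeight k m = k ! * (m ∸ k) !

centralWeight : ℕ → ℕ
centralWeight m = chainWeight ⌊ m /2⌋ m

chainWeight-pos : ∀ k m → 0 < chainWeight k m
chainWeight-pos k m = *-mono-< (1≤n! k) (1≤n! (m ∸ k))

rebalance-< : ∀ c b → b ≤ c → suc c ! * suc b ! < suc (suc c) ! * b !
rebalance-< c b b≤c = begin-strict
  suc c ! * (suc b * b !)       ≡⟨ *-Comm.x∙yz≈y∙xz (suc c !) (suc b) (b !) ⟩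
  suc b * (suc c ! * b !)       <⟨ *-monoˡ-< (suc c ! * b !) {{>-nonZero (*-mono-< (1≤n! (suc c)) (1≤n! b))}}
                                                (s≤s (s≤s b≤c)) ⟩
  suc (suc c) * (suc c ! * b !) ≡⟨ sym (*-assoc (suc (suc c)) (suc c !) (b !)) ⟩
  suc (suc c) ! * b !           ∎
  where open ≤-Reasoning

odd∸half : ∀ b → suc (b + b) ∸ b ≡ suc b
odd∸half b = trans (cong (_∸ b) (sym (+-suc b b))) (m+n∸m≡n b (suc b))

balanced-minimum : ∀ d b →
  centralWeight (b + d + b) ≤ (b + d) ! * b ! ×
  ((b + d) ! * b ! ≡ centralWeight (b + d + b) → d ≤ 1)
balanced-minimum zero b
  rewrite +-identityʳ b | sym (n≡⌊n+n/2⌋ b) | m+n∸m≡n b b = ≤-refl , λ _ → z≤n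
balanced-minimum (suc zero) b
  rewrite +-suc b 0 | +-identityʳ b | sym (n≡⌈n+n/2⌉ b) | odd∸half b =
  ≤-reflexive (*-comm (b !) (suc b !)) , λ _ → s≤s z≤n
balanced-minimum (suc (suc d)) b =
  ≤-trans shifted (<⇒≤ closer) , λ eq → ⊥-elim (<⇒≢ (≤-<-trans shifted closer) (sym eq))
  where
  same-total : suc b + d + suc b ≡ b + suc (suc d) + b
  same-total = trans (cong suc (+-suc (b + d) b))
    (sym (cong (_+ b) (trans (+-suc b (suc d)) (cong suc (+-suc b d)))))
  shifted : centralWeight (b + suc (suc d) + b) ≤ (suc b + d) ! * suc b !
  shifted = subst (λ m → centralWeight m ≤ (suc b + d) ! * suc b !) same-total
                  (proj₁ (balanced-minimum d (suc b)))
  closer : (suc b + d) ! * suc b ! < (b + suc (suc d)) ! * b !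
  closer rewrite +-suc b (suc d) | +-suc b d = rebalance-< (b + d) b (m≤m+n b d)

binomial-chains : ∀ {k m} → k ≤ m → (m C k) * chainWeight k m ≡ m !
binomial-chains {k} {m} k≤m = trans (cong (_* chainWeight k m) (nCk≡n!/k![n-k]! k≤m))
  (m/n*n≡m {{k !* (m ∸ k) !≢0}} (k![n∸k]!∣n! k≤m))

central-binomial : ∀ n k → k ≡ ⌊ n /2⌋ ⊎ k ≡ ⌈ n /2⌉ → n C k ≡ n C ⌊ n /2⌋
central-binomial n k (inj₁ k≡⌊n/2⌋) = cong (n C_) k≡⌊n/2⌋
central-binomial n k (inj₂ k≡⌈n/2⌉) = begin
  n C k                  ≡⟨ cong (n C_) k≡⌈n/2⌉ ⟩
  n C ⌈ n /2⌉            ≡⟨ nCk≡nC[n∸k] (⌈n/2⌉≤n n) ⟩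
  n C (n ∸ ⌈ n /2⌉)      ≡⟨ cong (λ j → n C (j ∸ ⌈ n /2⌉)) (sym (⌊n/2⌋+⌈n/2⌉≡n n)) ⟩
  n C (⌊ n /2⌋ + ⌈ n /2⌉ ∸ ⌈ n /2⌉) ≡⟨ cong (n C_) (m+n∸n≡m ⌊ n /2⌋ ⌈ n /2⌉) ⟩
  n C ⌊ n /2⌋            ∎
  where open ≡-Reasoning

even-halves : ∀ {n} → 2 ∣ n → ⌈ n /2⌉ ≡ ⌊ n /2⌋
even-halves (divides q refl) rewrite *-comm q 2 | +-identityʳ q = trans (sym (n≡⌈n+n/2⌉ q)) (n≡⌊n+n/2⌋ q)

split-parts : ∀ {k m} → k ≤ m →
  ∃[ b ] ∃[ d ] (m ≡ b + d + b × chainWeight k m ≡ (b + d) ! * b ! × (k ≡ b + d ⊎ k ≡ b))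
split-parts {k} {m} k≤m with ≤-total (m ∸ k) k
... | inj₁ r≤k = r , k ∸ r , m≡ , cong (λ j → j ! * r !) k≡ , inj₁ k≡
  where
  r = m ∸ k
  k≡ : k ≡ r + (k ∸ r)
  k≡ = sym (m+[n∸m]≡n r≤k)
  m≡ : m ≡ r + (k ∸ r) + r
  m≡ = trans (sym (m+[n∸m]≡n k≤m)) (cong (_+ r) k≡)
... | inj₂ k≤r = k , r ∸ k , m≡ , trans (*-comm (k !) (r !)) (cong (λ j → j ! * k !) r≡) , inj₂ refl
  where
  r = m ∸ k
  r≡ : r ≡ k + (r ∸ k)
  r≡ = sym (m+[n∸m]≡n k≤r)
  m≡ : m ≡ k + (r ∸ k) + k
  m≡ = trans (sym (m+[n∸m]≡n k≤m)) (trans (cong (k +_) r≡) (+-comm k (k + (r ∸ k))))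

near-centre : ∀ {k} b d → (k ≡ b + d ⊎ k ≡ b) → d ≤ 1 →
  k ≡ ⌊ b + d + b /2⌋ ⊎ k ≡ ⌈ b + d + b /2⌉
near-centre b zero k≡ _ =
  inj₁ (trans (either k≡) (trans (n≡⌊n+n/2⌋ b) (cong (λ j → ⌊ j + b /2⌋) (sym (+-identityʳ b)))))
  where
  either : ∀ {k} → k ≡ b + 0 ⊎ k ≡ b → k ≡ b
  either (inj₁ k≡) = trans k≡ (+-identityʳ b)
  either (inj₂ k≡) = k≡
near-centre b (suc zero) k≡ _ rewrite +-suc b 0 | +-identityʳ b with k≡
... | inj₁ k≡b+1 = inj₂ (trans k≡b+1 (cong suc (n≡⌊n+n/2⌋ b)))
... | inj₂ k≡b   = inj₁ (trans k≡b (n≡⌈n+n/2⌉ b))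
near-centre b (suc (suc d)) k≡ (s≤s ())

centralWeight-≤ : ∀ {k m} → k ≤ m → centralWeight m ≤ chainWeight k m
centralWeight-≤ k≤m with split-parts k≤m
... | b , d , refl , w≡ , _ =
  subst (centralWeight (b + d + b) ≤_) (sym w≡) (proj₁ (balanced-minimum d b))

centralWeight-≡ : ∀ {k m} → k ≤ m → chainWeight k m ≡ centralWeight m →
  k ≡ ⌊ m /2⌋ ⊎ k ≡ ⌈ m /2⌉
centralWeight-≡ k≤m w≡c with split-parts k≤m
... | b , d , refl , w≡ , k≡ = near-centre b d k≡ (proj₂ (balanced-minimum d b) (trans (sym w≡) w≡c))

familySum : {A : Set} → (A → ℕ) → List A → ℕ
familySum w []      = 0
familySum w (s ∷ F) = w s + familySum w F

familySum-cong : {A : Set} {v w : A → ℕ} (F : List A) → All (λ s → v s ≡ w s) F →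
  familySum v F ≡ familySum w F
familySum-cong []      []         = refl
familySum-cong (s ∷ F) (eq ∷ eqs) = cong₂ _+_ eq (familySum-cong F eqs)

familySum-zero : {A : Set} {w : A → ℕ} (F : List A) → (∀ s → w s ≡ 0) → familySum w F ≡ 0
familySum-zero []      w≡0 = refl
familySum-zero (s ∷ F) w≡0 = cong₂ _+_ (w≡0 s) (familySum-zero F w≡0)

familySum-map : {A B : Set} (w : B → ℕ) (f : A → B) (F : List A) →
  familySum w (map f F) ≡ familySum (w ∘ f) F
familySum-map w f []      = refl
familySum-map w f (s ∷ F) = cong (w (f s) +_) (familySum-map w f F)

familySum-≥ : {A : Set} (w : A → ℕ) (c : ℕ) (F : List A) → (∀ s → c ≤ w s) → length F * c ≤ familySum w F
familySum-≥ w c []      c≤w = z≤n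
familySum-≥ w c (s ∷ F) c≤w = +-mono-≤ (c≤w s) (familySum-≥ w c F c≤w)

familySum-tight : {A : Set} (w : A → ℕ) (c : ℕ) (F : List A) → (∀ s → c ≤ w s) →
  familySum w F ≤ length F * c → All (λ s → w s ≡ c) F
familySum-tight w c []      c≤w _  = []
familySum-tight w c (s ∷ F) c≤w ≤c = sym c≡w ∷ familySum-tight w c F c≤w (+-cancelˡ-≤ c _ _ rest≤)
  where
  c≡w : c ≡ w s
  c≡w = ≤-antisym (c≤w s) (+-cancelʳ-≤ (length F * c) (w s) c
    (≤-trans (+-monoʳ-≤ (w s) (familySum-≥ w c F c≤w)) ≤c))
  rest≤ : c + familySum w F ≤ c + length F * c
  rest≤ = subst (λ v → v + familySum w F ≤ c + length F * c) (sym c≡w) ≤c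

unique-⊆-length : {A : Set} {xs ys : List A} → Unique xs → (∀ {x} → x ∈ xs → x ∈ ys) →
  length xs ≤ length ys
unique-⊆-length {xs = []}     _             _     = z≤n
unique-⊆-length {xs = x ∷ xs} (x∉xs ∷ xs!) xs⊆ys with ∈-∃++ (xs⊆ys (here refl))
... | us , vs , refl = begin
  suc (length xs)              ≤⟨ s≤s (unique-⊆-length xs! xs⊆us++vs) ⟩
  suc (length (us ++ vs))      ≡⟨ cong suc (length-++ us) ⟩
  suc (length us + length vs)  ≡⟨ sym (+-suc (length us) (length vs)) ⟩
  length us + length (x ∷ vs)  ≡⟨ sym (length-++ us) ⟩
  length (us ++ x ∷ vs)        ∎
  where
  open ≤-Reasoning
  xs⊆us++vs : ∀ {y} → y ∈ xs → y ∈ us ++ vs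
  xs⊆us++vs y∈xs with ∈-++⁻ us (xs⊆ys (there y∈xs))
  ... | inj₁ y∈us          = ∈-++⁺ˡ y∈us
  ... | inj₂ (here refl)   = ⊥-elim (All.lookup x∉xs y∈xs refl)
  ... | inj₂ (there y∈vs)  = ∈-++⁺ʳ us y∈vs

allPairs-upgrade : {A : Set} {R S : A → A → Set} {P : A → Set} {xs : List A} →
  (∀ {x y} → P x → P y → R x y → S x y) → All P xs → AllPairs R xs → AllPairs S xs
allPairs-upgrade upgrade []         []           = []
allPairs-upgrade upgrade (px ∷ pxs) (rxs ∷ rxss) =
  All.zipWith (λ (py , rxy) → upgrade px py rxy) (pxs , rxs) ∷ allPairs-upgrade upgrade pxs rxss

familySum-sum : {A : Set} {n : ℕ} (h : A → Fin n → ℕ) (F : List A) →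
  familySum (λ s → sum (h s)) F ≡ sum (λ x → familySum (λ s → h s x) F)
familySum-sum {n = n} h []      = sym (sum-zero {n} λ _ → refl)
familySum-sum h (s ∷ F) = trans (cong (sum (h s) +_) (familySum-sum h F)) (sym (∑-distrib-+ (h s) _))

module Blocks {N M : ℕ} (blk : Fin N → Fin M) where

  inBlock : Fin M → Fin N → Bool
  inBlock i y = does (blk y ≟ i)

  part : (Fin N → Bool) → Fin M → Fin N → Bool
  part s i y = s y ∧ inBlock i y

  level : (Fin N → Bool) → Fin M → ℕ
  level s i = count (part s i)

  Separatedᵇ : (Fin N → Bool) → (Fin N → Bool) → Set
  Separatedᵇ s t = ∃[ j ] (¬ part s j ⊆ᵇ part t j × ¬ part t j ⊆ᵇ part s j)

  ∈part⇒∈ : ∀ s j y → part s j y ≡ true → s y ≡ true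
  ∈part⇒∈ s j y = ∧-conicalˡ (s y) (inBlock j y)

  ∈part⇒inBlock : ∀ s j y → part s j y ≡ true → inBlock j y ≡ true
  ∈part⇒inBlock s j y = ∧-conicalʳ (s y) (inBlock j y)

  part-mono : ∀ {s t : Fin N → Bool} → s ⊆ᵇ t → ∀ j → part s j ⊆ᵇ part t j
  part-mono {s} s⊆t j y y∈sⱼ = cong₂ _∧_ (s⊆t y (∈part⇒∈ s j y y∈sⱼ)) (∈part⇒inBlock s j y y∈sⱼ)

  inBlock-self : ∀ x → inBlock (blk x) x ≡ true
  inBlock-self x = dec-true (blk x ≟ blk x) refl

  inBlock-unique : ∀ {i j} x → inBlock i x ≡ true → inBlock j x ≡ true → i ≡ j
  inBlock-unique {i} {j} x xᵢ xⱼ with blk x ≟ i | blk x ≟ j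
  ... | yes x∈i | yes x∈j = trans (sym x∈i) x∈j

  level-remove : ∀ s x i → level s i ≡ 𝟙 (part s i x) + level (remove s x) i
  level-remove s x i = trans (count-remove (part s i) x)
    (cong (𝟙 (part s i x) +_) (count-cong λ y → ∧-Comm.xy∙z≈xz∙y (s y) (inBlock i y) _))

  level-remove-in : ∀ s x b → part s b x ≡ true → level s b ≡ suc (level (remove s x) b)
  level-remove-in s x b x∈sᵦ = trans (level-remove s x b) (cong (λ v → 𝟙 v + level (remove s x) b) x∈sᵦ)

  level-remove-out : ∀ s x i → part s i x ≡ false → level (remove s x) i ≡ level s i
  level-remove-out s x i x∉sᵢ =
    sym (trans (level-remove s x i) (cong (λ v → 𝟙 v + level (remove s x) i) x∉sᵢ))

  level-remove-other : ∀ s x {b i} → inBlock b x ≡ true → i ≢ b → level (remove s x) i ≡ level s i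
  level-remove-other s x {b} {i} x∈b i≢b = level-remove-out s x i x∉sᵢ
    where
    x∉sᵢ : part s i x ≡ false
    x∉sᵢ with inBlock i x in x∈i
    ... | true  = ⊥-elim (i≢b (inBlock-unique x x∈i x∈b))
    ... | false = ∧-zeroʳ (s x)

  -- Product chains of R: one maximal chain of R ∩ X_i for every block i.
  chains : (Fin N → Bool) → ℕ
  chains R = prodFin M (λ i → level R i !)

  -- Product chains of R passing through s (for s ⊆ R).
  weight : (Fin N → Bool) → (Fin N → Bool) → ℕ
  weight R s = prodFin M (λ i → chainWeight (level s i) (level R i))

  weight-≤-chains : ∀ R s → s ⊆ᵇ R → weight R s ≤ chains R
  weight-≤-chains R s s⊆R = prod-mono M λ i →
    ∣⇒≤ {{level R i !≢0}} (k![n∸k]!∣n! (count-mono (part-mono s⊆R i)))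

  chains-remove : ∀ R x b → part R b x ≡ true → chains R ≡ level R b * chains (remove R x)
  chains-remove R x b x∈Rᵦ = prod-update M b _ _ (level R b) factor≡
    (λ i i≢b → cong _! (sym (level-remove-other R x (∈part⇒inBlock R b x x∈Rᵦ) i≢b)))
    where
    factor≡ : level R b ! ≡ level R b * level (remove R x) b !
    factor≡ rewrite level-remove-in R x b x∈Rᵦ = refl

  weight-remove : ∀ R s x b → inBlock b x ≡ true → (∀ i → i ≢ b →
    chainWeight (level s i) (level R i) ≡ chainWeight (level (remove s x) i) (level (remove R x) i))
  weight-remove R s x b x∈b i i≢b =
    cong₂ chainWeight (sym (level-remove-other s x x∈b i≢b)) (sym (level-remove-other R x x∈b i≢b))

  -- Chains through s whose first element in block b is x ∈ s.
  weight-remove-in : ∀ R s x b → part R b x ≡ true → part s b x ≡ true →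
    weight R s ≡ level s b * weight (remove R x) (remove s x)
  weight-remove-in R s x b x∈Rᵦ x∈sᵦ =
    prod-update M b _ _ (level s b) factor≡ (weight-remove R s x b (∈part⇒inBlock R b x x∈Rᵦ))
    where
    factor≡ : chainWeight (level s b) (level R b) ≡
              level s b * chainWeight (level (remove s x) b) (level (remove R x) b)
    factor≡ rewrite level-remove-in R x b x∈Rᵦ | level-remove-in s x b x∈sᵦ =
      *-assoc (suc (level (remove s x) b)) (level (remove s x) b !)
              ((level (remove R x) b ∸ level (remove s x) b) !)

  -- When s misses block b, every x ∈ R ∩ X_b can come first.
  weight-remove-empty : ∀ R s x b → part R b x ≡ true → level s b ≡ 0 →
    weight R s ≡ level R b * weight (remove R x) (remove s x)
  weight-remove-empty R s x b x∈Rᵦ sᵦ≡0 =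
    prod-update M b _ _ (level R b) factor≡ (weight-remove R s x b (∈part⇒inBlock R b x x∈Rᵦ))
    where
    factor≡ : chainWeight (level s b) (level R b) ≡
              level R b * chainWeight (level (remove s x) b) (level (remove R x) b)
    factor≡ rewrite level-remove-out s x b (count-zero (part s b) sᵦ≡0 x) | sᵦ≡0
                  | level-remove-in R x b x∈Rᵦ =
      trans (*-identityˡ _) (cong (suc (level (remove R x) b) *_) (sym (*-identityˡ _)))

  -- x can be the first element of block b on a chain through s: either
  -- x ∈ s, or s misses block b altogether.
  admissible : Fin M → Fin N → (Fin N → Bool) → Bool
  admissible b x s = s x ∨ (level s b ≡ᵇ 0)

  -- Chains of R through s whose first element in block b is x.
  chainsVia : (Fin N → Bool) → Fin M → (Fin N → Bool) → Fin N → ℕ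
  chainsVia R b s x = 𝟙 (part R b x ∧ admissible b x s) * weight (remove R x) (remove s x)

  chainsVia-on : ∀ R b s x → part R b x ≡ true → admissible b x s ≡ true →
    chainsVia R b s x ≡ weight (remove R x) (remove s x)
  chainsVia-on R b s x x∈Rᵦ adm rewrite x∈Rᵦ | adm = +-identityʳ _

  chainsVia-off : ∀ R b s x → part R b x ∧ admissible b x s ≡ false → chainsVia R b s x ≡ 0
  chainsVia-off R b s x not-via = cong (λ v → 𝟙 v * weight (remove R x) (remove s x)) not-via

  decompose-empty : ∀ R s b x₀ → part R b x₀ ≡ true → level s b ≡ 0 →
    weight R s ≡ sum (chainsVia R b s)
  decompose-empty R s b x₀ x₀∈Rᵦ sᵦ≡0 = sym (*-cancelˡ-≡ _ _ (level R b) {{nonZero}}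
    (scaled-sum-≡ (level R b) (weight R s) (part R b) (chainsVia R b s) on off))
    where
    nonZero : NonZero (level R b)
    nonZero rewrite level-remove-in R x₀ b x₀∈Rᵦ = _
    on : ∀ x → part R b x ≡ true → level R b * chainsVia R b s x ≡ weight R s
    on x x∈Rᵦ = trans (cong (level R b *_) (chainsVia-on R b s x x∈Rᵦ admissible-x))
                      (sym (weight-remove-empty R s x b x∈Rᵦ sᵦ≡0))
      where
      admissible-x : admissible b x s ≡ true
      admissible-x rewrite sᵦ≡0 = ∨-zeroʳ (s x)
    off : ∀ x → part R b x ≡ false → chainsVia R b s x ≡ 0
    off x x∉Rᵦ = chainsVia-off R b s x (cong (_∧ admissible b x s) x∉Rᵦ)

  decompose-meets : ∀ R s b {k} → s ⊆ᵇ R → level s b ≡ suc k →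
    weight R s ≡ sum (chainsVia R b s)
  decompose-meets R s b {k} s⊆R sᵦ≡1+k = sym (*-cancelˡ-≡ _ _ (suc k)
    (trans (scaled-sum-≡ (suc k) (weight R s) (part s b) (chainsVia R b s) on off)
           (cong (_* weight R s) sᵦ≡1+k)))
    where
    on : ∀ x → part s b x ≡ true → suc k * chainsVia R b s x ≡ weight R s
    on x x∈sᵦ = trans (cong₂ _*_ (sym sᵦ≡1+k) (chainsVia-on R b s x x∈Rᵦ admissible-x))
                      (sym (weight-remove-in R s x b x∈Rᵦ x∈sᵦ))
      where
      x∈Rᵦ : part R b x ≡ true
      x∈Rᵦ = part-mono s⊆R b x x∈sᵦ
      admissible-x : admissible b x s ≡ true
      admissible-x rewrite ∈part⇒∈ s b x x∈sᵦ = refl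
    off : ∀ x → part s b x ≡ false → chainsVia R b s x ≡ 0
    off x x∉sᵦ = chainsVia-off R b s x not-via
      where
      not-via : part R b x ∧ admissible b x s ≡ false
      not-via with inBlock b x | s x
      ... | false | _     rewrite ∧-zeroʳ (R x) = refl
      ... | true  | false rewrite sᵦ≡1+k = ∧-zeroʳ (R x ∧ true)

  -- The chains through s, sorted by their first element in block b.
  weight-decompose : ∀ R s b x₀ → part R b x₀ ≡ true → s ⊆ᵇ R → weight R s ≡ sum (chainsVia R b s)
  weight-decompose R s b x₀ x₀∈Rᵦ s⊆R = by-level (level s b) refl
    where
    by-level : ∀ v → level s b ≡ v → weight R s ≡ sum (chainsVia R b s)
    by-level zero    = decompose-empty R s b x₀ x₀∈Rᵦ
    by-level (suc k) = decompose-meets R s b s⊆R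

  -- The members of F admissible at x, with x deleted: what the chains of R
  -- starting block b with x see inside R − x.
  shadow : Fin M → Fin N → List (Fin N → Bool) → List (Fin N → Bool)
  shadow b x [] = []
  shadow b x (s ∷ F) with admissible b x s
  ... | true  = remove s x ∷ shadow b x F
  ... | false = shadow b x F

  shadow-sum : ∀ R b x → part R b x ≡ true → (F : List (Fin N → Bool)) →
    familySum (λ s → chainsVia R b s x) F ≡ familySum (weight (remove R x)) (shadow b x F)
  shadow-sum R b x x∈Rᵦ [] = refl
  shadow-sum R b x x∈Rᵦ (s ∷ F) with admissible b x s
  ... | true  = cong₂ _+_ (trans (cong (λ v → 𝟙 v * W) (trans (∧-identityʳ _) x∈Rᵦ)) (*-identityˡ W))
                          (shadow-sum R b x x∈Rᵦ F)
    where W = weight (remove R x) (remove s x)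
  ... | false = cong₂ _+_ (cong (λ v → 𝟙 v * weight (remove R x) (remove s x)) (∧-zeroʳ (part R b x)))
                          (shadow-sum R b x x∈Rᵦ F)

  shadow-⊆ : ∀ R b x (F : List (Fin N → Bool)) → All (_⊆ᵇ R) F → All (_⊆ᵇ remove R x) (shadow b x F)
  shadow-⊆ R b x [] [] = []
  shadow-⊆ R b x (s ∷ F) (s⊆R ∷ F⊆R) with admissible b x s
  ... | true  = remove-mono s⊆R x ∷ shadow-⊆ R b x F F⊆R
  ... | false = shadow-⊆ R b x F F⊆R

  unremove-⊆ : ∀ s t x j → part (remove s x) j ⊆ᵇ part (remove t x) j →
    (part s j x ≡ true → t x ≡ true) → part s j ⊆ᵇ part t j
  unremove-⊆ s t x j sⱼ-x⊆tⱼ-x x-ok y y∈sⱼ with y ≟ x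
  ... | yes refl = cong₂ _∧_ (x-ok y∈sⱼ) (∈part⇒inBlock s j y y∈sⱼ)
  ... | no  y≢x  = part-mono (remove-⊆ t x) j y (sⱼ-x⊆tⱼ-x y y∈sⱼ-x)
    where
    y∈sⱼ-x : part (remove s x) j y ≡ true
    y∈sⱼ-x = cong₂ _∧_ (cong₂ _∧_ (∈part⇒∈ s j y y∈sⱼ) (cong not (dec-false (y ≟ x) y≢x)))
                       (∈part⇒inBlock s j y y∈sⱼ)

  -- If t is admissible at x and not below s in block j, then x ∈ sⱼ forces x ∈ t:
  -- otherwise t misses block b = j entirely.
  admissible-forces : ∀ s t x b j → inBlock b x ≡ true → admissible b x t ≡ true →
    ¬ part t j ⊆ᵇ part s j → part s j x ≡ true → t x ≡ true
  admissible-forces s t x b j x∈b adm tⱼ⊈sⱼ x∈sⱼ with t x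
  ... | true  = refl
  ... | false = ⊥-elim (tⱼ⊈sⱼ λ y y∈tⱼ → ⊥-elim (false≢true (trans (sym (tᵦ-empty y)) y∈tⱼ)))
    where
    j≡b : j ≡ b
    j≡b = inBlock-unique x (∈part⇒inBlock s j x x∈sⱼ) x∈b
    tᵦ-empty : ∀ y → part t j y ≡ false
    tᵦ-empty rewrite j≡b = count-zero (part t b) (≡ᵇ⇒≡ (level t b) 0 (subst T (sym adm) tt))

  separated-remove : ∀ b x s t → inBlock b x ≡ true → admissible b x s ≡ true → admissible b x t ≡ true →
    Separatedᵇ s t → Separatedᵇ (remove s x) (remove t x)
  separated-remove b x s t x∈b adm-s adm-t (j , sⱼ⊈tⱼ , tⱼ⊈sⱼ) =
    j , (λ below → sⱼ⊈tⱼ (unremove-⊆ s t x j below (admissible-forces s t x b j x∈b adm-t tⱼ⊈sⱼ)))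
      , (λ below → tⱼ⊈sⱼ (unremove-⊆ t s x j below (admissible-forces t s x b j x∈b adm-s sⱼ⊈tⱼ)))

  shadow-separated-from : ∀ b x s (F : List (Fin N → Bool)) → inBlock b x ≡ true →
    admissible b x s ≡ true → All (Separatedᵇ s) F → All (Separatedᵇ (remove s x)) (shadow b x F)
  shadow-separated-from b x s [] x∈b adm-s [] = []
  shadow-separated-from b x s (t ∷ F) x∈b adm-s (s-t ∷ s-F) with admissible b x t in adm-t
  ... | true  = separated-remove b x s t x∈b adm-s adm-t s-t
                ∷ shadow-separated-from b x s F x∈b adm-s s-F
  ... | false = shadow-separated-from b x s F x∈b adm-s s-F

  shadow-separated : ∀ b x (F : List (Fin N → Bool)) → inBlock b x ≡ true →
    AllPairs Separatedᵇ F → AllPairs Separatedᵇ (shadow b x F)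
  shadow-separated b x [] x∈b [] = []
  shadow-separated b x (s ∷ F) x∈b (s-F ∷ F-sep) with admissible b x s in adm-s
  ... | true  = shadow-separated-from b x s F x∈b adm-s s-F ∷ shadow-separated b x F x∈b F-sep
  ... | false = shadow-separated b x F x∈b F-sep

  -- Weighted LYM inequality relative to R, by induction on |R|: the chains of
  -- R through distinct members of a separated family are distinct.
  weighted-lym : ∀ n R → count R ≡ n → (F : List (Fin N → Bool)) → All (_⊆ᵇ R) F →
    AllPairs Separatedᵇ F → familySum (weight R) F ≤ chains R
  weighted-lym n R R≡n [] F⊆R F-sep = z≤n
  weighted-lym zero R R≡0 (s ∷ []) (s⊆R ∷ []) F-sep =
    ≤-trans (≤-reflexive (+-identityʳ _)) (weight-≤-chains R s s⊆R)
  weighted-lym zero R R≡0 (s ∷ t ∷ F) (s⊆R ∷ _) (((j , sⱼ⊈tⱼ , _) ∷ _) ∷ _) = ⊥-elim (sⱼ⊈tⱼ λ y y∈sⱼ →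
    ⊥-elim (false≢true (trans (sym (count-zero R R≡0 y)) (s⊆R y (∈part⇒∈ s j y y∈sⱼ)))))
  weighted-lym (suc n) R R≡1+n F F⊆R F-sep = *-cancelˡ-≤ (level R b) {{nonZero}} (begin
    level R b * familySum (weight R) F ≡⟨ cong (level R b *_) decomposed ⟩
    level R b * sum G                  ≤⟨ scaled-sum-≤ (level R b) (chains R) (part R b) G on off ⟩
    level R b * chains R               ∎)
    where
    open ≤-Reasoning
    x₀ = proj₁ (count-pos R R≡1+n)
    b  = blk x₀
    x₀∈Rᵦ : part R b x₀ ≡ true
    x₀∈Rᵦ = cong₂ _∧_ (proj₂ (count-pos R R≡1+n)) (inBlock-self x₀)
    nonZero : NonZero (level R b)
    nonZero rewrite level-remove-in R x₀ b x₀∈Rᵦ = _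
    G : Fin N → ℕ
    G x = familySum (λ s → chainsVia R b s x) F
    decomposed : familySum (weight R) F ≡ sum G
    decomposed = trans (familySum-cong F (All.map (weight-decompose R _ b x₀ x₀∈Rᵦ) F⊆R))
                       (familySum-sum (chainsVia R b) F)
    on : ∀ x → part R b x ≡ true → level R b * G x ≤ chains R
    on x x∈Rᵦ = begin
      level R b * G x                       ≡⟨ cong (level R b *_) (shadow-sum R b x x∈Rᵦ F) ⟩
      level R b * familySum (weight (remove R x)) (shadow b x F)
        ≤⟨ *-monoʳ-≤ (level R b) (weighted-lym n (remove R x) R-x≡n (shadow b x F)
             (shadow-⊆ R b x F F⊆R) (shadow-separated b x F (∈part⇒inBlock R b x x∈Rᵦ) F-sep)) ⟩
      level R b * chains (remove R x)       ≡⟨ sym (chains-remove R x b x∈Rᵦ) ⟩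
      chains R                              ∎
      where
      R-x≡n : count (remove R x) ≡ n
      R-x≡n = suc-injective (trans (sym (trans (count-remove R x)
                (cong (λ v → 𝟙 v + count (remove R x)) (∈part⇒∈ R b x x∈Rᵦ)))) R≡1+n)
    off : ∀ x → part R b x ≡ false → G x ≡ 0
    off x x∉Rᵦ = familySum-zero F (λ s → chainsVia-off R b s x (cong (_∧ admissible b x s) x∉Rᵦ))

mutual
  profileClass : ∀ {M} N → (Fin N → Fin M) → (Fin M → ℕ) → List (Subset N)
  profileClass zero blk ℓ with Fin.all? (λ i → ℓ i ≟ℕ 0)
  ... | yes _ = [] ∷ []
  ... | no  _ = []
  profileClass (suc N) blk ℓ =
    map (outside ∷_) (profileClass N (blk ∘ suc) ℓ) ++ insideClass N blk ℓ (ℓ (blk zero))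

  insideClass : ∀ {M} N → (Fin (suc N) → Fin M) → (Fin M → ℕ) → ℕ → List (Subset (suc N))
  insideClass N blk ℓ zero    = []
  insideClass N blk ℓ (suc k) =
    map (inside ∷_) (profileClass N (blk ∘ suc) (updateAt ℓ (blk zero) (λ _ → k)))

mutual
  profileClass-profile : ∀ {M} N (blk : Fin N → Fin M) ℓ S → S ∈ profileClass N blk ℓ →
    ∀ i → Blocks.level blk (lookup S) i ≡ ℓ i
  profileClass-profile zero blk ℓ S S∈ i with Fin.all? (λ i → ℓ i ≟ℕ 0)
  profileClass-profile zero blk ℓ .[] (here refl) i | yes ℓ≡0 = sym (ℓ≡0 i)
  profileClass-profile (suc N) blk ℓ S S∈ i
    with ∈-++⁻ (map (outside ∷_) (profileClass N (blk ∘ suc) ℓ)) S∈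
  ... | inj₁ S∈out with ∈-map⁻ (outside ∷_) S∈out
  ...   | p , p∈ , refl = profileClass-profile N (blk ∘ suc) ℓ p p∈ i
  profileClass-profile (suc N) blk ℓ S S∈ i | inj₂ S∈in =
    insideClass-profile N blk ℓ (ℓ (blk zero)) refl S S∈in i

  insideClass-profile : ∀ {M} N (blk : Fin (suc N) → Fin M) ℓ v → ℓ (blk zero) ≡ v →
    ∀ S → S ∈ insideClass N blk ℓ v →
    ∀ i → Blocks.level blk (lookup S) i ≡ ℓ i
  insideClass-profile N blk ℓ (suc k) ℓᵦ≡ S S∈ i with ∈-map⁻ (inside ∷_) S∈
  ... | p , p∈ , refl =
    trans (cong (𝟙 (does (blk zero ≟ i)) +_) (profileClass-profile N (blk ∘ suc) _ p p∈ i)) first-point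
    where
    first-point : 𝟙 (does (blk zero ≟ i)) + updateAt ℓ (blk zero) (λ _ → k) i ≡ ℓ i
    first-point with i ≟ blk zero
    ... | yes refl rewrite dec-true (blk zero ≟ blk zero) refl =
      trans (cong suc (updateAt-updates (blk zero) ℓ)) (sym ℓᵦ≡)
    ... | no  i≢b  rewrite dec-false (blk zero ≟ i) (i≢b ∘ sym) = updateAt-minimal i (blk zero) ℓ i≢b

mutual
  profileClass-length : ∀ {M} N (blk : Fin N → Fin M) ℓ →
    length (profileClass N blk ℓ) ≡ prodFin M (λ i → count (Blocks.inBlock blk i) C ℓ i)
  profileClass-length {M} zero blk ℓ with Fin.all? (λ i → ℓ i ≟ℕ 0)
  ... | yes ℓ≡0 = sym (prod-one M _ (λ i → cong (0 C_) (ℓ≡0 i)))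
  ... | no  ℓ≢0 = let i , ℓᵢ≢0 = Fin.¬∀⟶∃¬ M _ (λ i → ℓ i ≟ℕ 0) ℓ≢0 in
    sym (prod-zero M _ i (k>n⇒nCk≡0 (n≢0⇒n>0 ℓᵢ≢0)))
  profileClass-length (suc N) blk ℓ = begin
    length (map (outside ∷_) (profileClass N (blk ∘ suc) ℓ) ++ insideClass N blk ℓ (ℓ (blk zero)))
      ≡⟨ length-++ (map (outside ∷_) (profileClass N (blk ∘ suc) ℓ)) ⟩
    length (map (outside ∷_) (profileClass N (blk ∘ suc) ℓ)) + length (insideClass N blk ℓ (ℓ (blk zero)))
      ≡⟨ cong (_+ length (insideClass N blk ℓ (ℓ (blk zero))))
              (trans (length-map (outside ∷_) (profileClass N (blk ∘ suc) ℓ))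
                     (profileClass-length N (blk ∘ suc) ℓ)) ⟩
    _ ≡⟨ insideClass-length N blk ℓ (ℓ (blk zero)) refl ⟩
    _ ∎
    where open ≡-Reasoning

  -- Pascal's rule, block by block: the sets without the first point plus
  -- those with it.
  insideClass-length : ∀ {M} N (blk : Fin (suc N) → Fin M) ℓ v → ℓ (blk zero) ≡ v →
    prodFin M (λ i → count (Blocks.inBlock (blk ∘ suc) i) C ℓ i) + length (insideClass N blk ℓ v) ≡
    prodFin M (λ i → count (Blocks.inBlock blk i) C ℓ i)
  insideClass-length {M} N blk ℓ zero ℓᵦ≡0 = trans (+-identityʳ _) (prod-cong M same)
    where
    same : ∀ i → count (Blocks.inBlock (blk ∘ suc) i) C ℓ i ≡ count (Blocks.inBlock blk i) C ℓ i
    same i with i ≟ blk zero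
    ... | yes refl rewrite ℓᵦ≡0 = refl
    ... | no  i≢b  rewrite dec-false (blk zero ≟ i) (i≢b ∘ sym) = refl
  insideClass-length {M} N blk ℓ (suc k) ℓᵦ≡1+k = begin
    prodFin M (λ i → m′ i C ℓ i) + length (map (inside ∷_) (profileClass N (blk ∘ suc) ℓ′))
      ≡⟨ cong (prodFin M (λ i → m′ i C ℓ i) +_)
              (trans (length-map (inside ∷_) (profileClass N (blk ∘ suc) ℓ′))
                     (profileClass-length N (blk ∘ suc) ℓ′)) ⟩
    prodFin M (λ i → m′ i C ℓ i) + prodFin M (λ i → m′ i C ℓ′ i)
      ≡⟨ sym (prod-split M b _ _ _ pascal
               (λ i i≢b → cong (_C ℓ i) (off i i≢b))
               (λ i i≢b → cong₂ _C_ (off i i≢b) (sym (updateAt-minimal i b ℓ i≢b)))) ⟩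
    prodFin M (λ i → count (Blocks.inBlock blk i) C ℓ i) ∎
    where
    open ≡-Reasoning
    b  = blk zero
    m′ : _ → ℕ
    m′ i = count (Blocks.inBlock (blk ∘ suc) i)
    ℓ′ = updateAt ℓ b (λ _ → k)
    off : ∀ i → i ≢ b → count (Blocks.inBlock blk i) ≡ m′ i
    off i i≢b rewrite dec-false (b ≟ i) (i≢b ∘ sym) = refl
    pascal : count (Blocks.inBlock blk b) C ℓ b ≡ m′ b C ℓ b + m′ b C ℓ′ b
    pascal rewrite dec-true (b ≟ b) refl | ℓᵦ≡1+k | updateAt-updates b {λ _ → k} ℓ =
      trans (sym (nCk+nC[k+1]≡[n+1]C[k+1] (m′ b) k)) (+-comm (m′ b C k) _)

-- No set is listed twice: the two halves differ at the first point.
insideClass-head : ∀ {M} N (blk : Fin (suc N) → Fin M) ℓ v S → S ∈ insideClass N blk ℓ v →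
  lookup S zero ≡ true
insideClass-head N blk ℓ (suc k) S S∈ with ∈-map⁻ (inside ∷_) S∈
... | _ , _ , refl = refl

mutual
  profileClass-unique : ∀ {M} N (blk : Fin N → Fin M) ℓ → Unique (profileClass N blk ℓ)
  profileClass-unique zero blk ℓ with Fin.all? (λ i → ℓ i ≟ℕ 0)
  ... | yes _ = [] ∷ []
  ... | no  _ = []
  profileClass-unique (suc N) blk ℓ =
    Unique.++⁺ (Unique.map⁺ Vec.∷-injectiveʳ (profileClass-unique N (blk ∘ suc) ℓ))
               (insideClass-unique N blk ℓ (ℓ (blk zero))) disjoint
    where
    disjoint : ∀ {S} → ¬ (S ∈ map (outside ∷_) (profileClass N (blk ∘ suc) ℓ)
                         × S ∈ insideClass N blk ℓ (ℓ (blk zero)))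
    disjoint (S∈out , S∈in) with ∈-map⁻ (outside ∷_) S∈out
    ... | p , _ , refl = false≢true (insideClass-head N blk ℓ (ℓ (blk zero)) _ S∈in)

  insideClass-unique : ∀ {M} N (blk : Fin (suc N) → Fin M) ℓ v → Unique (insideClass N blk ℓ v)
  insideClass-unique N blk ℓ zero    = []
  insideClass-unique N blk ℓ (suc k) = Unique.map⁺ Vec.∷-injectiveʳ (profileClass-unique N (blk ∘ suc) _)

card≡count : ∀ {n} (p : Subset n) → ∣ p ∣ ≡ count (lookup p)
card≡count []          = refl
card≡count (true ∷ p)  = cong suc (card≡count p)
card≡count (false ∷ p) = card≡count p

⊆⇔⊆ᵇ : ∀ {n} (p q : Subset n) → p ⊆ q ⇔ lookup p ⊆ᵇ lookup q
⊆⇔⊆ᵇ p q = mk⇔ (λ p⊆q y py → Vec.[]=⇒lookup (p⊆q (Vec.lookup⇒[]= y p py)))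
                (λ p⊆q {y} y∈p → Vec.lookup⇒[]= y q (p⊆q y (Vec.[]=⇒lookup y∈p)))

lookup-injective : ∀ {n} (p q : Subset n) → lookup p ≗ lookup q → p ≡ q
lookup-injective p q p≗q = trans (sym (Vec.tabulate∘lookup p))
  (trans (Vec.tabulate-cong p≗q) (Vec.tabulate∘lookup q))

module Extremal {N M : ℕ} (blk : Fin N → Fin M) where
  open Blocks blk

  open DecMembership {A = Subset N} (Vec.≡-dec Bool._≟_) using (_∈?_)

  lookup-block : ∀ i → lookup (block blk i) ≗ inBlock i
  lookup-block i y = trans (Vec.lookup∘tabulate _ y) (inside-if (inBlock i y))
    where
    inside-if : ∀ b → (if b then inside else outside) ≡ b
    inside-if true  = refl
    inside-if false = refl

  lookup-part : ∀ S i → lookup (S ∩ block blk i) ≗ part (lookup S) i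
  lookup-part S i y =
    trans (Vec.lookup-zipWith _∧_ y S (block blk i)) (cong (lookup S y ∧_) (lookup-block i y))

  profile≡level : ∀ S i → profile blk S i ≡ level (lookup S) i
  profile≡level S i = trans (card≡count (S ∩ block blk i)) (count-cong (lookup-part S i))

  everything : Fin N → Bool
  everything _ = true

  blockSize≡level : ∀ i → blockSize blk i ≡ level everything i
  blockSize≡level i = trans (card≡count (block blk i)) (count-cong (lookup-block i))

  ∩block-⊆⇔ : ∀ S T j → (S ∩ block blk j ⊆ T ∩ block blk j) ⇔ (part (lookup S) j ⊆ᵇ part (lookup T) j)
  ∩block-⊆⇔ S T j = mk⇔ to from
    where
    to : S ∩ block blk j ⊆ T ∩ block blk j → part (lookup S) j ⊆ᵇ part (lookup T) j
    to S⊆T y y∈S = trans (sym (lookup-part T j y))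
      (Equivalence.to (⊆⇔⊆ᵇ (S ∩ block blk j) (T ∩ block blk j)) S⊆T y (trans (lookup-part S j y) y∈S))
    from : part (lookup S) j ⊆ᵇ part (lookup T) j → S ∩ block blk j ⊆ T ∩ block blk j
    from S⊆T = Equivalence.from (⊆⇔⊆ᵇ (S ∩ block blk j) (T ∩ block blk j))
      λ y y∈S → trans (lookup-part T j y) (S⊆T y (trans (sym (lookup-part S j y)) y∈S))

  separated⇔ : ∀ S T → Separated blk S T ⇔ Separatedᵇ (lookup S) (lookup T)
  separated⇔ S T = mk⇔
    (λ (j , S⊈T , T⊈S) →
       j , S⊈T ∘ Equivalence.from (∩block-⊆⇔ S T j) , T⊈S ∘ Equivalence.from (∩block-⊆⇔ T S j))
    (λ (j , S⊈T , T⊈S) →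
       j , S⊈T ∘ Equivalence.to (∩block-⊆⇔ S T j) , T⊈S ∘ Equivalence.to (∩block-⊆⇔ T S j))

  -- Two sets with the same profile that differ at y are separated by the
  -- block of y: neither part there can contain the other without equality.
  same-profile-separated : ∀ S T → profile blk S ≗ profile blk T → S ≢ T → Separated blk S T
  same-profile-separated S T same S≢T with Fin.all? (λ y → lookup S y Bool.≟ lookup T y)
  ... | yes S≗T = ⊥-elim (S≢T (lookup-injective S T S≗T))
  ... | no  S≉T = Equivalence.from (separated⇔ S T)
        (blk y , not-below (lookup S) (lookup T) level≡ Sʸ≢Tʸ
               , not-below (lookup T) (lookup S) (sym level≡) (Sʸ≢Tʸ ∘ sym))
    where
    y = proj₁ (Fin.¬∀⟶∃¬ N _ (λ y → lookup S y Bool.≟ lookup T y) S≉T)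
    Sʸ≢Tʸ : lookup S y ≢ lookup T y
    Sʸ≢Tʸ = proj₂ (Fin.¬∀⟶∃¬ N _ (λ y → lookup S y Bool.≟ lookup T y) S≉T)
    level≡ : level (lookup S) (blk y) ≡ level (lookup T) (blk y)
    level≡ = trans (sym (profile≡level S (blk y))) (trans (same (blk y)) (profile≡level T (blk y)))
    not-below : ∀ s t → level s (blk y) ≡ level t (blk y) → s y ≢ t y →
      ¬ part s (blk y) ⊆ᵇ part t (blk y)
    not-below s t sⱼ≡tⱼ sʸ≢tʸ sⱼ⊆tⱼ = sʸ≢tʸ (begin
      s y                       ≡⟨ sym (∧-identityʳ (s y)) ⟩
      s y ∧ true                ≡⟨ cong (s y ∧_) (sym (inBlock-self y)) ⟩
      part s (blk y) y          ≡⟨ ⇔→≡ (mk⇔ (sⱼ⊆tⱼ y) (⊆ᵇ-count-≡ sⱼ⊆tⱼ sⱼ≡tⱼ y)) ⟩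
      part t (blk y) y          ≡⟨ cong (t y ∧_) (inBlock-self y) ⟩
      t y ∧ true                ≡⟨ ∧-identityʳ (t y) ⟩
      t y                       ∎)
      where open ≡-Reasoning

  m : Fin M → ℕ
  m i = blockSize blk i

  centralCount : ℕ
  centralCount = prodFin M (λ i → m i C ⌊ m i /2⌋)

  allChains : ℕ
  allChains = prodFin M (λ i → m i !)

  chainsThrough : Subset N → ℕ
  chainsThrough S = prodFin M (λ i → chainWeight (profile blk S i) (m i))

  minChains : ℕ
  minChains = prodFin M (λ i → centralWeight (m i))

  half : Fin M → ℕ
  half i = ⌊ m i /2⌋

  Central : (Fin M → ℕ) → Set
  Central ℓ = ∀ i → ℓ i ≡ ⌊ m i /2⌋ ⊎ ℓ i ≡ ⌈ m i /2⌉

  valid-lym : ∀ F → Valid blk F → familySum chainsThrough F ≤ allChains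
  valid-lym F valid = begin
    familySum chainsThrough F
      ≡⟨ familySum-cong F (All.tabulate λ {S} _ → prod-cong M λ i →
           cong₂ chainWeight (profile≡level S i) (blockSize≡level i)) ⟩
    familySum (weight everything ∘ lookup) F
      ≡⟨ sym (familySum-map (weight everything) lookup F) ⟩
    familySum (weight everything) (map lookup F)
      ≤⟨ weighted-lym _ everything refl (map lookup F) (All.tabulate λ _ _ _ → refl)
             (AllPairs.map⁺ (AllPairs.map (Equivalence.to (separated⇔ _ _)) valid)) ⟩
    chains everything
      ≡⟨ prod-cong M (λ i → cong _! (sym (blockSize≡level i))) ⟩
    allChains ∎
    where open ≤-Reasoning

  profile≤m : ∀ S i → profile blk S i ≤ m i
  profile≤m S i = ∣p∩q∣≤∣q∣ S (block blk i)

  minChains≤ : ∀ S → minChains ≤ chainsThrough S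
  minChains≤ S = prod-mono M (λ i → centralWeight-≤ (profile≤m S i))

  minChains-pos : 0 < minChains
  minChains-pos = prod-pos M _ (λ i → chainWeight-pos ⌊ m i /2⌋ (m i))

  centralCount*minChains : centralCount * minChains ≡ allChains
  centralCount*minChains = trans (prod-mul M _ _) (prod-cong M (λ i → binomial-chains (⌊n/2⌋≤n (m i))))

  size-bound : ∀ F → Valid blk F → length F ≤ centralCount
  size-bound F valid = *-cancelʳ-≤ (length F) centralCount minChains {{>-nonZero minChains-pos}} (begin
    length F * minChains       ≤⟨ familySum-≥ chainsThrough minChains F minChains≤ ⟩
    familySum chainsThrough F  ≤⟨ valid-lym F valid ⟩
    allChains                  ≡⟨ sym centralCount*minChains ⟩
    centralCount * minChains   ∎)
    where open ≤-Reasoning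

  centralCount≢0 : centralCount ≢ 0
  centralCount≢0 count≡0 = <⇒≢ (prod-pos M _ (λ i → 1≤n! (m i)))
    (sym (trans (sym centralCount*minChains) (cong (_* minChains) count≡0)))

  class-profile : ∀ ℓ S → S ∈ profileClass N blk ℓ → profile blk S ≗ ℓ
  class-profile ℓ S S∈ i = trans (profile≡level S i) (profileClass-profile N blk ℓ S S∈ i)

  class-valid : ∀ ℓ → Valid blk (profileClass N blk ℓ)
  class-valid ℓ = allPairs-upgrade
    (λ {S} {T} S≗ℓ T≗ℓ S≢T → same-profile-separated S T (λ i → trans (S≗ℓ i) (sym (T≗ℓ i))) S≢T)
    (All.tabulate (λ {S} → class-profile ℓ S)) (profileClass-unique N blk ℓ)

  class-length : ∀ ℓ → Central ℓ → length (profileClass N blk ℓ) ≡ centralCount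
  class-length ℓ central = trans (profileClass-length N blk ℓ) (prod-cong M λ i →
    trans (cong (_C ℓ i) (sym (blockSize≡level i))) (central-binomial (m i) (ℓ i) (central i)))

  maximum-size : ∀ F → Maximum blk F → length F ≡ centralCount
  maximum-size F (valid , maximal) = ≤-antisym (size-bound F valid)
    (subst (_≤ length F) (class-length half (λ _ → inj₁ refl)) (maximal _ (class-valid half)))

  -- In a maximum family the LYM inequality is tight, so every member lies
  -- on exactly minChains chains, which forces a central profile.
  maximum-central : ∀ F → Maximum blk F → ∀ {S} → S ∈ F → Central (profile blk S)
  maximum-central F max@(valid , _) {S} S∈F i = centralWeight-≡ (profile≤m S i) (factor≡ i)
    where
    tight : All (λ S → chainsThrough S ≡ minChains) F
    tight = familySum-tight chainsThrough minChains F minChains≤ (begin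
      familySum chainsThrough F ≤⟨ valid-lym F valid ⟩
      allChains                 ≡⟨ sym centralCount*minChains ⟩
      centralCount * minChains  ≡⟨ cong (_* minChains) (sym (maximum-size F max)) ⟩
      length F * minChains      ∎)
      where open ≤-Reasoning
    factor≡ : ∀ i → chainWeight (profile blk S i) (m i) ≡ centralWeight (m i)
    factor≡ = prod-tight M (λ i → centralWeight (m i)) (λ i → chainWeight (profile blk S i) (m i))
      (λ i → centralWeight-≤ (profile≤m S i)) (λ i → chainWeight-pos ⌊ m i /2⌋ (m i))
      (All.lookup tight S∈F)

  -- A maximum homogeneous family is a single central profile class: it
  -- contains the whole class of any member, and that class alone already has
  -- the maximum size.
  homogeneous-maximum⇒class : ∀ F → Homogeneous blk F → Maximum blk F →
    ∃[ ℓ ] (Central ℓ × ∀ S → (S ∈ F) ⇔ (profile blk S ≗ ℓ))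
  homogeneous-maximum⇒class [] hom max = ⊥-elim (centralCount≢0 (sym (maximum-size [] max)))
  homogeneous-maximum⇒class F@(S₀ ∷ _) hom max =
    ℓ , maximum-central F max (here refl) , λ S → mk⇔ (in-class S) (by-homogeneity S)
    where
    ℓ = profile blk S₀
    by-homogeneity : ∀ T → profile blk T ≗ ℓ → T ∈ F
    by-homogeneity T T≗ℓ = hom S₀ T (λ i → sym (T≗ℓ i)) (here refl)
    class⊆F : ∀ {T} → T ∈ profileClass N blk ℓ → T ∈ F
    class⊆F {T} T∈ = by-homogeneity T (class-profile ℓ T T∈)
    in-class : ∀ S → S ∈ F → profile blk S ≗ ℓ
    in-class S S∈F with Fin.all? (λ i → profile blk S i ≟ℕ ℓ i)
    ... | yes S≗ℓ = S≗ℓ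
    ... | no  S≉ℓ = ⊥-elim (1+n≰n (begin
      suc centralCount
        ≡⟨ cong suc (sym (class-length ℓ (maximum-central F max (here refl)))) ⟩
      length (S ∷ profileClass N blk ℓ)         ≤⟨ unique-⊆-length unique S∷class⊆F ⟩
      length F                                  ≡⟨ maximum-size F max ⟩
      centralCount                              ∎))
      where
      open ≤-Reasoning
      unique : Unique (S ∷ profileClass N blk ℓ)
      unique = All.tabulate (λ {T} T∈ S≡T →
                 S≉ℓ (subst (λ U → profile blk U ≗ ℓ) (sym S≡T) (class-profile ℓ T T∈)))
               ∷ profileClass-unique N blk ℓ
      S∷class⊆F : ∀ {T} → T ∈ S ∷ profileClass N blk ℓ → T ∈ F
      S∷class⊆F (here refl) = S∈F
      S∷class⊆F (there T∈)  = class⊆F T∈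

  class⇒homogeneous-maximum : ∀ F → Valid blk F →
    ∃[ ℓ ] (Central ℓ × ∀ S → (S ∈ F) ⇔ (profile blk S ≗ ℓ)) → Homogeneous blk F × Maximum blk F
  class⇒homogeneous-maximum F valid (ℓ , central , F≡class) =
    hom , valid , λ G G-valid → ≤-trans (size-bound G G-valid) (begin
    centralCount                  ≡⟨ sym (class-length ℓ central) ⟩
    length (profileClass N blk ℓ) ≤⟨ unique-⊆-length (profileClass-unique N blk ℓ)
                                       (λ {T} T∈ → Equivalence.from (F≡class T) (class-profile ℓ T T∈)) ⟩
    length F                      ∎)
    where
    open ≤-Reasoning
    hom : Homogeneous blk F
    hom S T same S∈F =
      Equivalence.from (F≡class T) (λ i → trans (sym (same i)) (Equivalence.to (F≡class S) S∈F i))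

  -- With all blocks even the only central profile is half, so a maximum
  -- family is exactly the class of half: its members have that profile, and
  -- any missing set of that profile could be added to it.
  module _ (even : ∀ i → 2 ∣ m i) where

    maximum-half : ∀ F → Maximum blk F → ∀ {S} → S ∈ F → profile blk S ≗ half
    maximum-half F max S∈F i with maximum-central F max S∈F i
    ... | inj₁ S≡⌊m/2⌋ = S≡⌊m/2⌋
    ... | inj₂ S≡⌈m/2⌉ = trans S≡⌈m/2⌉ (even-halves (even i))

    maximum-contains-half : ∀ F → Maximum blk F → ∀ S → profile blk S ≗ half → S ∈ F
    maximum-contains-half F max@(valid , maximal) S S≗half with S ∈? F
    ... | yes S∈F = S∈F
    ... | no  S∉F = ⊥-elim (1+n≰n (maximal (S ∷ F) (separated-from-F ∷ valid)))
      where
      separated-from-F : All (Separated blk S) F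
      separated-from-F = All.tabulate λ {T} T∈F → same-profile-separated S T
        (λ i → trans (S≗half i) (sym (maximum-half F max T∈F i)))
        (λ S≡T → S∉F (subst (_∈ F) (sym S≡T) T∈F))

    maximum-homogeneous : ∀ F → Maximum blk F → Homogeneous blk F
    maximum-homogeneous F max S T same S∈F =
      maximum-contains-half F max T (λ i → trans (sym (same i)) (maximum-half F max S∈F i))

    maximum-unique : ∀ F G → Maximum blk F → Maximum blk G → ∀ S → (S ∈ F) ⇔ (S ∈ G)
    maximum-unique F G max-F max-G S = mk⇔
      (λ S∈F → maximum-contains-half G max-G S (maximum-half F max-F S∈F))
      (λ S∈G → maximum-contains-half F max-F S (maximum-half G max-G S∈G))

-- Theorem 6.3: the maximum size, the maximum homogeneous families, and the
-- even case.
theorem6p3 : {N M : ℕ} (blk : Fin N → Fin M) →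
    (∀ i → 1 ≤ blockSize blk i) →
    ((𝓕 : List (Subset N)) → Maximum blk 𝓕 →
       length 𝓕 ≡ prodFin M (λ i → blockSize blk i C ⌊ blockSize blk i /2⌋))
    × ((𝓕 : List (Subset N)) → Valid blk 𝓕 →
       ((Homogeneous blk 𝓕 × Maximum blk 𝓕) ⇔
        (∃[ ℓ ] ((∀ i → ℓ i ≡ ⌊ blockSize blk i /2⌋ ⊎ ℓ i ≡ ⌈ blockSize blk i /2⌉)
                 × (∀ S → (S ∈ 𝓕) ⇔ (profile blk S ≗ ℓ))))))
    × ((∀ i → 2 ∣ blockSize blk i) →
       ((𝓕 : List (Subset N)) → Maximum blk 𝓕 → Homogeneous blk 𝓕)
       × ((𝓕 𝓖 : List (Subset N)) → Maximum blk 𝓕 → Maximum blk 𝓖 →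
          ∀ S → (S ∈ 𝓕) ⇔ (S ∈ 𝓖)))
theorem6p3 blk _ =
    maximum-size
  , (λ 𝓕 valid → mk⇔ (λ (hom , max) → homogeneous-maximum⇒class 𝓕 hom max)
                     (class⇒homogeneous-maximum 𝓕 valid))
  , (λ even → maximum-homogeneous even , maximum-unique even)
  where open Extremal blk
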